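{- Let $k\in\mathbb{N}$, let $\mathsf{D}$ be a DP-core with identity cleaning equipped with a witness action $\rho$, let $F=(f_1,\dots,f_m)$ be a sequence of $k$-relabeling functions, let $R=(b_0,S_0)(b_1,S_1)\cdots(b_m,S_m)$ be a semi $F$-relabeled $(k,\mathsf{D})$-refutation, and let $g:b_m\to[k+1]$ be a $k$-relabeling function. Then there exist a $k$-instructive tree decomposition $\tau_R\in\mathcal{T}_k$ and a function $T$ from the set of subterm occurrences of $\tau_R$ to finite subsets of $\mathcal{W}_k$ such that: $B(\tau_R)=g(b_m)$; $T(\tau_R)=\rho(g,S_m)$; and for each subterm $\tau$ of $\tau_R$: if $\tau=\mathtt{Leaf}$ then $T(\tau)=\mathtt{Leaf}_k$; if $\tau=\mathtt{IntroVertex}_u(\tau_1)$ then $T(\tau)=\mathtt{IntroVertex}_u(T(\tau_1))$; if $\tau=\mathtt{ForgetVertex}_u(\tau_1)$ then $T(\tau)=\mathtt{ForgetVertex}_u(T(\tau_1))$; if $\tau=\mathtt{IntroEdge}_{u,v}(\tau_1)$ then $T(\tau)=\mathtt{IntroEdge}_{u,v}(T(\tau_1))$; if $\tau=\mathtt{Join}(\tau_1,\tau_2)$ then $T(\tau)=\mathtt{Join}(T(\tau_1),T(\tau_2))$.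
   Context: Instructive decompositions: the $k$-instructive alphabet has $\mathtt{Leaf}$ (arity 0), $\mathtt{IntroVertex}_u,\mathtt{ForgetVertex}_u$ ($u\in[k+1]$), $\mathtt{IntroEdge}_{u,v}$ (distinct $u,v\in[k+1]$) of arity 1, and $\mathtt{Join}$ of arity 2. $\mathcal{T}_k$ is the set of terms legal w.r.t. bags: $B(\mathtt{Leaf})=\emptyset$; $\mathtt{IntroVertex}_u(\sigma)$ requires $u\notin B(\sigma)$, bag $B(\sigma)\cup\{u\}$; $\mathtt{ForgetVertex}_u(\sigma)$ requires $u\in B(\sigma)$, bag $B(\sigma)\setminus\{u\}$; $\mathtt{IntroEdge}_{u,v}(\sigma)$ requires $u,v\in B(\sigma)$, bag $B(\sigma)$; $\mathtt{Join}(\sigma_1,\sigma_2)$ requires $B(\sigma_1)=B(\sigma_2)$, same bag. (In a join, the two children are disjoint copies.) DP-core level $\mathsf{D}[k]$: witnesses $\mathcal{W}_k\subseteq\{0,1\}^*$, $\mathtt{Final}_k$, finite $\mathtt{Leaf}_k$, transitions $\mathtt{IntroVertex}_u,\mathtt{ForgetVertex}_u,\mathtt{IntroEdge}_{u,v}:\mathcal{W}_k\to$ finite subsets, $\mathtt{Join}:\mathcal{W}_k^2\to$ finite subsets, lifted to finite sets by union ($\mathtt{Join}(S,S')=\bigcup_{w\in S,w'\in S'}\mathtt{Join}(w,w')$); identity cleaning means the cleaning function is the identity. A witness is final if $\mathtt{Final}_k(w)=1$. Labels and actions: each witness $w$ has $\mathrm{Lbl}_k(w)\subseteq[k+1]$,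 $\mathrm{Lbl}_k(S)=\bigcup_{w\in S}\mathrm{Lbl}_k(w)$; a state $(b,S)$ ($b\subseteq[k+1]$, $S\subseteq\mathcal{W}_k$ finite) is well-formed if $\mathrm{Lbl}_k(S)\subseteq b$. A $k$-relabeling function is an injective $f:b\to[k+1]$ with $b\subseteq[k+1]$; $\mathcal{F}_k$ is their set; $f^{ -1}$ is the inverse on the image; $f\circ g$ the partial composition. A witness action for $\mathsf{D}[k]$ is a partial map $\rho(f,w)\in\mathcal{W}_k$ defined exactly when $\mathrm{Lbl}_k(w)\subseteq\mathrm{dom}(f)$, extended pointwise to sets, such that whenever defined: finality preserved; $\mathrm{Lbl}_k(\rho(f,w))=f(\mathrm{Lbl}_k(w))$; $\rho(f^{ -1},\rho(f,w))=w$; $\rho(f\circ f',w)=\rho(f,\rho(f',w))$; $\rho(f',w)=\rho(f,w)$ if $f'$ extends $f$; $\rho(f,\mathtt{IntroVertex}_u(w))=\mathtt{IntroVertex}_{f(u)}(\rho(f,w))$ and $\rho(f,\mathtt{ForgetVertex}_u(w))=\mathtt{ForgetVertex}_{f(u)}(\rho(f,w))$ ($u\in\mathrm{dom} f$); $\rho(f,\mathtt{IntroEdge}_{u,v}(w))=\mathtt{IntroEdge}_{f(u),f(v)}(\rho(f,w))$ (distinct $u,v\in\mathrm{dom} f$); $\rho(f,\mathtt{Join}(w,w'))=\mathtt{Join}(\rho(f,w),\rho(f,w'))$ ($\mathrm{Lbl}_k(w')\subseteq\mathrm{dom} f$). Semi relabeled refutation: given $F=(f_1,\dots,f_m)$ in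 $\mathcal{F}_k$, a semi $F$-relabeled $(k,\mathsf{D})$-refutation is a sequence of states $(b_0,S_0),\dots,(b_m,S_m)$ with $(b_0,S_0)=(\emptyset,\mathtt{Leaf}_k)$, all states well-formed, and for each $i\in[m]$ some $j<i$ such that $(b_i,S_i)$ equals one of: $(f_i(b_j\cup\{u\}),\rho(f_i,\mathtt{IntroVertex}_u(S_j)))$ with $u\notin b_j$; $(f_i(b_j\setminus\{u\}),\rho(f_i,\mathtt{ForgetVertex}_u(S_j)))$ with $u\in b_j$; $(f_i(b_j),\rho(f_i,\mathtt{IntroEdge}_{u,v}(S_j)))$ with distinct $u,v\in b_j$; $(f_i(b_j),\rho(f_i,\mathtt{Join}(S_j,\rho(\pi,S_l))))$ with $l<i$, $b_l=b_j$, $\pi$ a permutation of $b_j$; in each case $\mathrm{dom}(f_i)$ equals the bag to which $f_i$ is applied (respectively $b_j\cup\{u\}$, $b_j\setminus\{u\}$, $b_j$, $b_j$). (No condition is imposed on consistency of the last state.) -}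

module Defs where

open import Data.Nat using (ℕ; suc; _≤_)
open import Data.Unit using (⊤)
open import Data.Fin as Fin using (Fin; toℕ)
open import Data.Fin.Subset using (Subset; _∈_; _∉_; _∪_; _-_; ⁅_⁆; ⊥)
open import Data.Bool using (Bool)
open import Data.Maybe using (Maybe; just; _>>=_)
open import Data.List using (List; map; concatMap)
open import Data.List.Membership.Propositional using () renaming (_∈_ to _∈ₗ_)
open import Data.Product using (Σ; ∃; _×_; _,_)
open import Relation.Binary.PropositionalEquality using (_≡_)
open import Relation.Nullary using (¬_)

infix 3 _⇔_
_⇔_ : Set → Set → Set
A ⇔ B = (A → B) × (B → A)

Lab : ℕ → Set
Lab k = Fin (suc k)

Bag : ℕ → Set
Bag k = Subset (suc k)

data Term (k : ℕ) : Set where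
  Leaf        : Term k
  IntroVertex  : Lab k → Term k → Term k
  ForgetVertex : Lab k → Term k → Term k
  IntroEdge    : Lab k → Lab k → Term k → Term k
  Join         : Term k → Term k → Term k

B : ∀ {k} → Term k → Bag k
B Leaf                 = ⊥
B (IntroVertex u σ)    = B σ ∪ ⁅ u ⁆
B (ForgetVertex u σ)   = B σ - u
B (IntroEdge u v σ)    = B σ
B (Join σ₁ σ₂)         = B σ₁

Legal : ∀ {k} → Term k → Set
Legal Leaf                 = ⊤
Legal (IntroVertex u σ)    = Legal σ × u ∉ B σ
Legal (ForgetVertex u σ)   = Legal σ × u ∈ B σ
Legal (IntroEdge u v σ)    = Legal σ × u ∈ B σ × v ∈ B σ × ¬ (u ≡ v)
Legal (Join σ₁ σ₂)         = Legal σ₁ × Legal σ₂ × B σ₁ ≡ B σ₂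

-- k-relabeling functions: injective partial maps [k+1] ⇀ [k+1]
-- (the domain b is the set of points where the map is defined)

record Relab (k : ℕ) : Set where
  field
    fn  : Lab k → Maybe (Lab k)
    inj : ∀ x y z → fn x ≡ just z → fn y ≡ just z → x ≡ y
open Relab public

_∈dom_ : ∀ {k} → Lab k → Relab k → Set
u ∈dom f = ∃ λ y → fn f u ≡ just y

DomIs : ∀ {k} → Relab k → Bag k → Set
DomIs f b = ∀ u → u ∈ b ⇔ u ∈dom f

ImgIs : ∀ {k} → Relab k → Bag k → Bag k → Set
ImgIs f b c = ∀ u → u ∈ c ⇔ (∃ λ v → v ∈ b × fn f v ≡ just u)

Extends : ∀ {k} → Relab k → Relab k → Set
Extends f′ f = ∀ x y → fn f x ≡ just y → fn f′ x ≡ just y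

IsInverse : ∀ {k} → Relab k → Relab k → Set
IsInverse g f = (∀ u → u ∈dom g ⇔ (∃ λ v → fn f v ≡ just u))
              × (∀ v u → fn f v ≡ just u → fn g u ≡ just v)

IsComp : ∀ {k} → Relab k → Relab k → Relab k → Set
IsComp h f f′ = ∀ x → fn h x ≡ (fn f′ x >>= fn f)

IsPerm : ∀ {k} → Relab k → Bag k → Set
IsPerm π b = DomIs π b × ImgIs π b b

-- Finite sets of witnesses are represented by lists, compared as sets.

infix 4 _≋_
_≋_ : ∀ {W : Set} → List W → List W → Set
S ≋ S′ = ∀ w → w ∈ₗ S ⇔ w ∈ₗ S′

-- DP-core level D[k] with identity cleaning, with labels.
-- (The cleaning function is the identity and hence not represented.)

record DPCore (k : ℕ) : Set₁ where
  field
    W            : Set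
    Final        : W → Bool
    LeafW        : List W
    IntroVertexW  : Lab k → W → List W
    ForgetVertexW : Lab k → W → List W
    IntroEdgeW    : Lab k → Lab k → W → List W
    JoinW         : W → W → List W
    Lbl           : W → Bag k

  IntroVertexS : Lab k → List W → List W
  IntroVertexS u = concatMap (IntroVertexW u)

  ForgetVertexS : Lab k → List W → List W
  ForgetVertexS u = concatMap (ForgetVertexW u)

  IntroEdgeS : Lab k → Lab k → List W → List W
  IntroEdgeS u v = concatMap (IntroEdgeW u v)

  JoinS : List W → List W → List W
  JoinS S S′ = concatMap (λ w → concatMap (λ w′ → JoinW w w′) S′) S

  LblS⊆ : List W → (Lab k → Set) → Set
  LblS⊆ S X = ∀ w u → w ∈ₗ S → u ∈ Lbl w → X u

  WellFormed : Bag k → List W → Set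
  WellFormed b S = LblS⊆ S (λ u → u ∈ b)

module _ {k : ℕ} (D : DPCore k) where
  open DPCore D

  Defd : Relab k → W → Set
  Defd f w = ∀ u → u ∈ Lbl w → u ∈dom f

  DefdS : Relab k → List W → Set
  DefdS f S = LblS⊆ S (λ u → u ∈dom f)

-- A witness action.  ρ is represented as a total function whose values
-- are only meaningful (and only constrained) where ρ(f,w) is defined,
-- i.e. when Lbl(w) ⊆ dom f.  Equations hold whenever both sides are defined.
record WitnessAction {k : ℕ} (D : DPCore k) : Set where
  open DPCore D
  field
    ρ : Relab k → W → W

  ρS : Relab k → List W → List W
  ρS f = map (ρ f)

  field
    final-pres : ∀ f w → Defd D f w → Final (ρ f w) ≡ Final w
    lbl        : ∀ f w → Defd D f w →
                 ∀ u → u ∈ Lbl (ρ f w) ⇔ (∃ λ v → v ∈ Lbl w × fn f v ≡ just u)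
    inverse    : ∀ f g w → IsInverse g f → Defd D f w → ρ g (ρ f w) ≡ w
    compose    : ∀ h f f′ w → IsComp h f f′ → Defd D h w →
                 ρ h w ≡ ρ f (ρ f′ w)
    extend     : ∀ f f′ w → Extends f′ f → Defd D f w → ρ f′ w ≡ ρ f w
    introV     : ∀ f u u′ w → fn f u ≡ just u′ → Defd D f w →
                 DefdS D f (IntroVertexW u w) →
                 ρS f (IntroVertexW u w) ≋ IntroVertexW u′ (ρ f w)
    forgetV    : ∀ f u u′ w → fn f u ≡ just u′ → Defd D f w →
                 DefdS D f (ForgetVertexW u w) →
                 ρS f (ForgetVertexW u w) ≋ ForgetVertexW u′ (ρ f w)
    introE     : ∀ f u u′ v v′ w → ¬ (u ≡ v) → fn f u ≡ just u′ → fn f v ≡ just v′ →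
                 Defd D f w → DefdS D f (IntroEdgeW u v w) →
                 ρS f (IntroEdgeW u v w) ≋ IntroEdgeW u′ v′ (ρ f w)
    join       : ∀ f w w′ → Defd D f w → Defd D f w′ → DefdS D f (JoinW w w′) →
                 ρS f (JoinW w w′) ≋ JoinW (ρ f w) (ρ f w′)

module Refutation {k : ℕ} (D : DPCore k) (A : WitnessAction D) where
  open DPCore D
  open WitnessAction A

  record State : Set where
    constructor ⟨_,_⟩
    field
      bag  : Bag k
      wits : List W
  open State public

  -- the possible ways the state (bᵢ,Sᵢ) arises from earlier states, given fᵢ.
  -- `earlier j` means j < i.
  data Step (earlier : State → Set) (f : Relab k) (st : State) : Set where
    step-introV : ∀ bj Sj u → earlier ⟨ bj , Sj ⟩ → u ∉ bj →
             DomIs f (bj ∪ ⁅ u ⁆) → DefdS D f (IntroVertexS u Sj) →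
             ImgIs f (bj ∪ ⁅ u ⁆) (bag st) →
             wits st ≋ ρS f (IntroVertexS u Sj) → Step earlier f st
    step-forgetV : ∀ bj Sj u → earlier ⟨ bj , Sj ⟩ → u ∈ bj →
             DomIs f (bj - u) → DefdS D f (ForgetVertexS u Sj) →
             ImgIs f (bj - u) (bag st) →
             wits st ≋ ρS f (ForgetVertexS u Sj) → Step earlier f st
    step-introE : ∀ bj Sj u v → earlier ⟨ bj , Sj ⟩ → u ∈ bj → v ∈ bj → ¬ (u ≡ v) →
             DomIs f bj → DefdS D f (IntroEdgeS u v Sj) →
             ImgIs f bj (bag st) →
             wits st ≋ ρS f (IntroEdgeS u v Sj) → Step earlier f st
    step-join   : ∀ bj Sj Sl (π : Relab k) → earlier ⟨ bj , Sj ⟩ → earlier ⟨ bj , Sl ⟩ →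
             IsPerm π bj →
             DomIs f bj → DefdS D f (JoinS Sj (ρS π Sl)) →
             ImgIs f bj (bag st) →
             wits st ≋ ρS f (JoinS Sj (ρS π Sl)) → Step earlier f st

  -- R : Fin (suc m) → State is a semi F-relabeled (k,D)-refutation, where
  -- F : Fin m → Relab k lists f₁,…,f_m (fᵢ = F (i-1)); state i+1 is obtained
  -- from states with index ≤ i using F i.
  record SemiRefutation (m : ℕ) (F : Fin m → Relab k) (R : Fin (suc m) → State) : Set where
    field
      initial-bag  : bag (R Fin.zero) ≡ ⊥
      initial-wits : wits (R Fin.zero) ≋ LeafW
      well-formed  : ∀ i → WellFormed (bag (R i)) (wits (R i))
      steps        : ∀ (i : Fin m) →
                     Step (λ st → ∃ λ (j : Fin (suc m)) → toℕ j ≤ toℕ i × R j ≡ st)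
                          (F i) (R (Fin.suc i))

  -- Terms decorated with a finite witness set at each subterm occurrence
  -- (a function T from the subterm occurrences of a term to finite sets).

  data DTerm : Set where
    dLeaf         : List W → DTerm
    dIntroVertex  : List W → Lab k → DTerm → DTerm
    dForgetVertex : List W → Lab k → DTerm → DTerm
    dIntroEdge    : List W → Lab k → Lab k → DTerm → DTerm
    dJoin         : List W → DTerm → DTerm → DTerm

  term : DTerm → Term k
  term (dLeaf _)               = Leaf
  term (dIntroVertex _ u τ)    = IntroVertex u (term τ)
  term (dForgetVertex _ u τ)   = ForgetVertex u (term τ)
  term (dIntroEdge _ u v τ)    = IntroEdge u v (term τ)
  term (dJoin _ τ₁ τ₂)         = Join (term τ₁) (term τ₂)

  T : DTerm → List W
  T (dLeaf S)               = S
  T (dIntroVertex S _ _)    = S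
  T (dForgetVertex S _ _)   = S
  T (dIntroEdge S _ _ _)    = S
  T (dJoin S _ _)           = S

  Coherent : DTerm → Set
  Coherent (dLeaf S)              = S ≋ LeafW
  Coherent (dIntroVertex S u τ)   = S ≋ IntroVertexS u (T τ) × Coherent τ
  Coherent (dForgetVertex S u τ)  = S ≋ ForgetVertexS u (T τ) × Coherent τ
  Coherent (dIntroEdge S u v τ)   = S ≋ IntroEdgeS u v (T τ) × Coherent τ
  Coherent (dJoin S τ₁ τ₂)        = S ≋ JoinS (T τ₁) (T τ₂) × Coherent τ₁ × Coherent τ₂

-- The decomposition is read off the refutation backwards, by strong induction on the index of a
-- state and with the final relabeling carried along: to decompose state i under g, decompose the
-- state it was derived from under g ∘ fᵢ (the second argument of a join under g ∘ fᵢ ∘ π, which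
-- gives it the same bag as the first), and apply the operation of step i with its labels renamed
-- by g ∘ fᵢ.  The equivariance axioms of ρ turn ρ(g, Sᵢ) = ρ(g ∘ fᵢ, op(Sⱼ)) into
-- op(ρ(g ∘ fᵢ, Sⱼ)), which is the local condition at the new root.  At a leaf the witnesses carry
-- no labels, and a label-free witness is fixed by every relabeling.  The one non-local point is
-- ForgetVertex_u: g ∘ fᵢ is undefined at u, so it is first extended by sending u to a label outside
-- its image; such a label exists because an injective map into [k+1] that is undefined somewhere
-- cannot be onto.

{-# OPTIONS --safe #-}
module Submission where

open import Defs
open import Data.Nat using (ℕ; suc)
open import Data.Fin using (Fin; fromℕ)
open import Data.Product using (Σ; ∃; _×_)

open import Level using (0ℓ)
open import Function using (id; _∘_)
open import Function.Definitions using (Injective)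
open import Data.Unit using (tt)
open import Data.Sum using (inj₁; inj₂)
open import Data.Product using (_,_; proj₁; proj₂; swap)
open import Data.Nat using (_≤_; s≤s)
open import Data.Nat.Properties using (1+n≰n)
open import Data.Fin using (toℕ; punchOut) renaming (zero to fzero; suc to fsuc; _<_ to _<ᶠ_)
open import Data.Fin.Properties using (_≟_; any?; ¬∀⟶∃¬; injective⇒≤; punchOut-injective)
open import Data.Fin.Induction using (<-wellFounded)
open import Data.Fin.Subset using (Subset; _∈_; _∉_; _∪_; _─_; _-_; ⁅_⁆; ⊥; inside; outside)
open import Data.Fin.Subset.Properties
  using (∉⊥; x∈⁅x⁆; x∈⁅y⁆⇒x≡y; x∈p∪q⁺; x∈p∪q⁻; x∈p∧x≢y⇒x∈p-y; p─q⊆p; ⊆-antisym)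
open import Data.Vec using (_∷_; here; there)
open import Data.Maybe using (Maybe; just; nothing; _>>=_)
open import Data.Maybe.Properties using (just-injective; ≡-dec)
open import Data.List using (List; map; concatMap)
open import Data.List.Properties
  using (map-∘; map-cong-local; map-id-local; map-concatMap; concatMap-map)
open import Data.List.Relation.Unary.All using (tabulate)
open import Data.List.Membership.Propositional using (find; lose) renaming (_∈_ to _∈ₗ_)
open import Data.List.Membership.Propositional.Properties
  using (∈-map⁺; ∈-map⁻; ∈-concatMap⁺; ∈-concatMap⁻)
open import Data.List.Relation.Binary.Subset.Propositional using () renaming (_⊆_ to _⊆ₗ_)
open import Data.List.Relation.Binary.Subset.Propositional.Properties
  using (map⁺; concatMap⁺)
open import Induction.WellFounded using (module All)
open import Relation.Binary.Bundles using (Setoid)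
import Relation.Binary.Reasoning.Setoid as SetoidReasoning
open import Relation.Binary.PropositionalEquality
  using (_≡_; _≢_; refl; sym; trans; cong; subst; module ≡-Reasoning)
open import Relation.Nullary using (¬_; Dec; yes; no; contradiction)

module _ {A : Set} where

  ≋-refl : {S : List A} → S ≋ S
  ≋-refl _ = id , id

  ≋-sym : {S S′ : List A} → S ≋ S′ → S′ ≋ S
  ≋-sym S≋S′ x = swap (S≋S′ x)

  ≋-trans : {S S′ S″ : List A} → S ≋ S′ → S′ ≋ S″ → S ≋ S″
  ≋-trans S≋S′ S′≋S″ x =
    proj₁ (S′≋S″ x) ∘ proj₁ (S≋S′ x) , proj₂ (S≋S′ x) ∘ proj₂ (S′≋S″ x)

  ≋-setoid : Setoid 0ℓ 0ℓ
  ≋-setoid = record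
    { Carrier       = List A
    ; _≈_           = _≋_
    ; isEquivalence = record { refl = ≋-refl ; sym = ≋-sym ; trans = ≋-trans }
    }

module ≋-Reasoning {A : Set} = SetoidReasoning (≋-setoid {A})

module _ {A B : Set} where

  map-cong-≋ : (f : A → B) {S S′ : List A} → S ≋ S′ → map f S ≋ map f S′
  map-cong-≋ f S≋S′ _ =
    map⁺ f (λ {x} → proj₁ (S≋S′ x)) , map⁺ f (λ {x} → proj₂ (S≋S′ x))

  concatMap-congʳ-≋ : (f : A → List B) {S S′ : List A} →
                      S ≋ S′ → concatMap f S ≋ concatMap f S′
  concatMap-congʳ-≋ f S≋S′ _ =
    concatMap⁺ f (λ {x} → proj₁ (S≋S′ x)) , concatMap⁺ f (λ {x} → proj₂ (S≋S′ x))

  concatMap-⊆ : {f g : A → List B} {S : List A} →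
                (∀ {x} → x ∈ₗ S → f x ⊆ₗ g x) → concatMap f S ⊆ₗ concatMap g S
  concatMap-⊆ {f} {g} f⊆g y∈ =
    let x , x∈ , y∈fx = find (∈-concatMap⁻ f y∈) in ∈-concatMap⁺ g (lose x∈ (f⊆g x∈ y∈fx))

  concatMap-congˡ-≋ : {f g : A → List B} {S : List A} →
                      (∀ {x} → x ∈ₗ S → f x ≋ g x) → concatMap f S ≋ concatMap g S
  concatMap-congˡ-≋ f≋g _ =
    concatMap-⊆ (λ x∈ → proj₁ (f≋g x∈ _)) , concatMap-⊆ (λ x∈ → proj₂ (f≋g x∈ _))

  map-concatMap-≋ : (h : A → B) (op : A → List A) (op′ : B → List B) {S : List A} →
                    (∀ {x} → x ∈ₗ S → map h (op x) ≋ op′ (h x)) →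
                    map h (concatMap op S) ≋ concatMap op′ (map h S)
  map-concatMap-≋ h op op′ {S} commute = begin
    map h (concatMap op S)    ≡⟨ map-concatMap h op S ⟩
    concatMap (map h ∘ op) S  ≈⟨ concatMap-congˡ-≋ commute ⟩
    concatMap (op′ ∘ h) S     ≡⟨ concatMap-map op′ h S ⟨
    concatMap op′ (map h S)   ∎
    where open ≋-Reasoning

>>=-just⁻ : {A B : Set} (m : Maybe A) {k : A → Maybe B} {z : B} →
            (m >>= k) ≡ just z → ∃ λ y → m ≡ just y × k y ≡ just z
>>=-just⁻ (just y) k-y = y , refl , k-y

>>=-just⁺ : {A B : Set} {m : Maybe A} {k : A → Maybe B} {y : A} {z : B} →
            m ≡ just y → k y ≡ just z → (m >>= k) ≡ just z
>>=-just⁺ refl k-y = k-y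

x∈p─q⇒x∉q : ∀ {n} (p q : Subset n) {x} → x ∈ p ─ q → x ∉ q
x∈p─q⇒x∉q (_ ∷ p) (outside ∷ q) here        ()
x∈p─q⇒x∉q (_ ∷ p) (inside ∷ q)  {fzero} ()
x∈p─q⇒x∉q (_ ∷ p) (_ ∷ q)       (there x∈) (there x∈q) = x∈p─q⇒x∉q p q x∈ x∈q

x∈p-y⇒x≢y : ∀ {n} {p : Subset n} {x y} → x ∈ p - y → x ≢ y
x∈p-y⇒x≢y {p = p} {y = y} x∈ refl = x∈p─q⇒x∉q p ⁅ y ⁆ x∈ (x∈⁅x⁆ y)

module _ {k : ℕ} where

  _⊆dom_ : Bag k → Relab k → Set
  b ⊆dom f = ∀ u → u ∈ b → u ∈dom f

  InImage : Relab k → Lab k → Set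
  InImage h y = ∃ λ x → fn h x ≡ just y

  ∉dom⇒nothing : (f : Relab k) {u : Lab k} → ¬ (u ∈dom f) → fn f u ≡ nothing
  ∉dom⇒nothing f {u} u∉ with fn f u
  ... | nothing = refl
  ... | just y  = contradiction (y , refl) u∉

  ∅ᵣ : Relab k
  fn ∅ᵣ _ = nothing
  inj ∅ᵣ _ _ _ ()

  ∅ᵣ-self-inverse : IsInverse ∅ᵣ ∅ᵣ
  ∅ᵣ-self-inverse = (λ _ → (λ ()) , (λ ())) , (λ _ _ ())

  infixr 9 _∘ᵣ_
  _∘ᵣ_ : Relab k → Relab k → Relab k
  fn (g ∘ᵣ f) x = fn f x >>= fn g
  inj (g ∘ᵣ f) x x′ z gf-x gf-x′ =
    let y  , f-x  , g-y  = >>=-just⁻ (fn f x) gf-x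
        y′ , f-x′ , g-y′ = >>=-just⁻ (fn f x′) gf-x′
    in inj f x x′ y f-x (trans f-x′ (cong just (inj g y′ y z g-y′ g-y)))

  ⊆dom-∘ : (g f : Relab k) {b : Bag k} → b ⊆dom f →
           (∀ z → (∃ λ v → v ∈ b × fn f v ≡ just z) → z ∈dom g) → b ⊆dom (g ∘ᵣ f)
  ⊆dom-∘ g f b⊆f fb⊆g v v∈ =
    let y , f-v = b⊆f v v∈
        z , g-y = fb⊆g y (v , v∈ , f-v)
    in z , >>=-just⁺ f-v g-y

  ⊆dom-∘-img : (g f : Relab k) {b c : Bag k} →
               DomIs f b → ImgIs f b c → c ⊆dom g → b ⊆dom (g ∘ᵣ f)
  ⊆dom-∘-img g f dom-f img-f c⊆g =
    ⊆dom-∘ g f (λ v → proj₁ (dom-f v)) (λ z fb∋z → c⊆g z (proj₂ (img-f z) fb∋z))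

  module _ (h : Relab k) (u : Lab k) (y : Lab k) (y-fresh : ¬ InImage h y) where

    extendAt : Relab k
    fn extendAt x with x ≟ u
    ... | yes _ = just y
    ... | no _  = fn h x
    inj extendAt x x′ z hx hx′ with x ≟ u | x′ ≟ u
    ... | yes x≡u | yes x′≡u = trans x≡u (sym x′≡u)
    ... | yes _   | no _     = contradiction (x′ , trans hx′ (sym hx)) y-fresh
    ... | no _    | yes _    = contradiction (x , trans hx (sym hx′)) y-fresh
    ... | no _    | no _     = inj h x x′ z hx hx′

    extendAt-at : fn extendAt u ≡ just y
    extendAt-at with u ≟ u
    ... | yes _   = refl
    ... | no u≢u  = contradiction refl u≢u

    extendAt-off : ∀ {x} → x ≢ u → fn extendAt x ≡ fn h x
    extendAt-off {x} x≢u with x ≟ u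
    ... | yes x≡u = contradiction x≡u x≢u
    ... | no _    = refl

    extendAt-extends : fn h u ≡ nothing → Extends extendAt h
    extendAt-extends h-u x z h-x = trans (extendAt-off x≢u) h-x
      where
      x≢u : x ≢ u
      x≢u refl with () ← trans (sym h-u) h-x

    ⊆dom-extendAt : {b : Bag k} → (b - u) ⊆dom h → b ⊆dom extendAt
    ⊆dom-extendAt b-u⊆h v v∈ = defined-at (v ≟ u)
      where
      defined-at : Dec (v ≡ u) → v ∈dom extendAt
      defined-at (yes refl) = y , extendAt-at
      defined-at (no v≢u)   =
        let z , h-v = b-u⊆h v (x∈p∧x≢y⇒x∈p-y v∈ v≢u) in z , trans (extendAt-off v≢u) h-v

  surjective⇒defined : (h : Relab k) → (∀ y → InImage h y) → ∀ {u} → fn h u ≢ nothing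
  surjective⇒defined h onto {u} h-u = 1+n≰n (injective⇒≤ preimage-injective)
    where
    u≢preimage : ∀ y → u ≢ proj₁ (onto y)
    u≢preimage y u≡x with () ← trans (sym h-u) (trans (cong (fn h) u≡x) (proj₂ (onto y)))

    preimage : Lab k → Fin k
    preimage y = punchOut (u≢preimage y)

    preimage-injective : Injective _≡_ _≡_ preimage
    preimage-injective {y} {y′} eq = just-injective (begin
      just y                  ≡⟨ proj₂ (onto y) ⟨
      fn h (proj₁ (onto y))   ≡⟨ cong (fn h) (punchOut-injective (u≢preimage y) (u≢preimage y′) eq) ⟩
      fn h (proj₁ (onto y′))  ≡⟨ proj₂ (onto y′) ⟩
      just y′                 ∎)
      where open ≡-Reasoning

  ∃-unused-label : (h : Relab k) {u : Lab k} → fn h u ≡ nothing → ∃ λ y → ¬ InImage h y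
  ∃-unused-label h h-u =
    ¬∀⟶∃¬ (suc k) (InImage h) (λ y → any? λ x → ≡-dec _≟_ (fn h x) (just y))
      (λ onto → surjective⇒defined h onto h-u)

  ImgIs-⊥ : (g : Relab k) → ImgIs g ⊥ ⊥
  ImgIs-⊥ g z = (λ z∈ → contradiction z∈ ∉⊥) , (λ (_ , v∈ , _) → contradiction v∈ ∉⊥)

  ImgIs-∘ : (g f : Relab k) {b c d : Bag k} → ImgIs f b c → ImgIs (g ∘ᵣ f) b d → ImgIs g c d
  ImgIs-∘ g f {b} {c} {d} img-f img-gf z = to , from
    where
    to : z ∈ d → ∃ λ y → y ∈ c × fn g y ≡ just z
    to z∈ = let v , v∈ , gf-v = proj₁ (img-gf z) z∈
                y , f-v , g-y = >>=-just⁻ (fn f v) gf-v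
            in y , proj₂ (img-f y) (v , v∈ , f-v) , g-y
    from : (∃ λ y → y ∈ c × fn g y ≡ just z) → z ∈ d
    from (y , y∈ , g-y) = let v , v∈ , f-v = proj₁ (img-f y) y∈
                          in proj₂ (img-gf z) (v , v∈ , >>=-just⁺ f-v g-y)

  ImgIs-insert : (h : Relab k) {b d : Bag k} {u u′ : Lab k} → ImgIs h b d → fn h u ≡ just u′ →
                 ImgIs h (b ∪ ⁅ u ⁆) (d ∪ ⁅ u′ ⁆)
  ImgIs-insert h {b} {d} {u} {u′} img h-u z = to , from
    where
    to : z ∈ d ∪ ⁅ u′ ⁆ → ∃ λ v → v ∈ b ∪ ⁅ u ⁆ × fn h v ≡ just z
    to z∈ with x∈p∪q⁻ d ⁅ u′ ⁆ z∈
    ... | inj₁ z∈d = let v , v∈ , h-v = proj₁ (img z) z∈d in v , x∈p∪q⁺ (inj₁ v∈) , h-v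
    ... | inj₂ z∈u′ rewrite x∈⁅y⁆⇒x≡y u′ z∈u′ = u , x∈p∪q⁺ (inj₂ (x∈⁅x⁆ u)) , h-u
    from : (∃ λ v → v ∈ b ∪ ⁅ u ⁆ × fn h v ≡ just z) → z ∈ d ∪ ⁅ u′ ⁆
    from (v , v∈ , h-v) with x∈p∪q⁻ b ⁅ u ⁆ v∈
    ... | inj₁ v∈b = x∈p∪q⁺ (inj₁ (proj₂ (img z) (v , v∈b , h-v)))
    ... | inj₂ v∈u rewrite x∈⁅y⁆⇒x≡y u v∈u | just-injective (trans (sym h-u) h-v) =
      x∈p∪q⁺ (inj₂ (x∈⁅x⁆ z))

  ImgIs-remove : (h : Relab k) {b d : Bag k} {u y : Lab k} → ImgIs h b d → fn h u ≡ just y →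
                 ImgIs h (b - u) (d - y)
  ImgIs-remove h {b} {d} {u} {y} img h-u z = to , from
    where
    to : z ∈ d - y → ∃ λ v → v ∈ b - u × fn h v ≡ just z
    to z∈ = let v , v∈ , h-v = proj₁ (img z) (p─q⊆p d ⁅ y ⁆ z∈)
                v≢u v≡u = x∈p-y⇒x≢y z∈
                  (just-injective (trans (sym h-v) (trans (cong (fn h) v≡u) h-u)))
            in v , x∈p∧x≢y⇒x∈p-y v∈ v≢u , h-v
    from : (∃ λ v → v ∈ b - u × fn h v ≡ just z) → z ∈ d - y
    from (v , v∈ , h-v) = x∈p∧x≢y⇒x∈p-y (proj₂ (img z) (v , p─q⊆p b ⁅ u ⁆ v∈ , h-v))
      (λ z≡y → x∈p-y⇒x≢y v∈ (inj h v u y (trans h-v (cong just z≡y)) h-u))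

  ImgIs-cong : (g h : Relab k) {b d : Bag k} →
               (∀ v → v ∈ b → fn g v ≡ fn h v) → ImgIs g b d → ImgIs h b d
  ImgIs-cong g h g≗h img z =
    (λ z∈ → let v , v∈ , g-v = proj₁ (img z) z∈ in v , v∈ , trans (sym (g≗h v v∈)) g-v) ,
    (λ (v , v∈ , h-v) → proj₂ (img z) (v , v∈ , trans (g≗h v v∈) h-v))

  ImgIs-unique : (h : Relab k) {b d d′ : Bag k} → ImgIs h b d → ImgIs h b d′ → d ≡ d′
  ImgIs-unique h img img′ =
    ⊆-antisym (λ {z} z∈ → proj₂ (img′ z) (proj₁ (img z) z∈))
              (λ {z} z∈ → proj₂ (img z) (proj₁ (img′ z) z∈))

module CoreProperties {k : ℕ} (D : DPCore k) where
  open DPCore D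

  wellFormed⇒DefdS : (h : Relab k) {b : Bag k} {S : List W} →
                     WellFormed b S → b ⊆dom h → DefdS D h S
  wellFormed⇒DefdS h wf b⊆h w u w∈ u∈ = b⊆h u (wf w u w∈ u∈)

  DefdS-concatMap⁻ : (h : Relab k) (op : W → List W) {S : List W} {w : W} →
                     DefdS D h (concatMap op S) → w ∈ₗ S → DefdS D h (op w)
  DefdS-concatMap⁻ h op defd w∈ x u x∈ = defd x u (∈-concatMap⁺ op (lose w∈ x∈))

  JoinS-cong : {S₁ S₁′ S₂ S₂′ : List W} →
               S₁ ≋ S₁′ → S₂ ≋ S₂′ → JoinS S₁ S₂ ≋ JoinS S₁′ S₂′
  JoinS-cong {S₁′ = S₁′} {S₂} {S₂′} S₁≋ S₂≋ =
    ≋-trans (concatMap-congʳ-≋ (λ w → concatMap (JoinW w) S₂) S₁≋)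
            (concatMap-congˡ-≋ {S = S₁′} (λ {w} _ → concatMap-congʳ-≋ (JoinW w) S₂≋))

module ActionProperties {k : ℕ} {D : DPCore k} (A : WitnessAction D) where
  open DPCore D
  open WitnessAction A
  open CoreProperties D

  ρ-unlabelled : (g : Relab k) {w : W} → (∀ u → u ∉ Lbl w) → ρ g w ≡ w
  ρ-unlabelled g {w} unlabelled = begin
    ρ g w          ≡⟨ extend ∅ᵣ g w (λ _ _ ()) ∅ᵣ-defd ⟩
    ρ ∅ᵣ w         ≡⟨ compose ∅ᵣ ∅ᵣ ∅ᵣ w (λ _ → refl) ∅ᵣ-defd ⟩
    ρ ∅ᵣ (ρ ∅ᵣ w)  ≡⟨ inverse ∅ᵣ ∅ᵣ w ∅ᵣ-self-inverse ∅ᵣ-defd ⟩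
    w              ∎
    where
    open ≡-Reasoning
    ∅ᵣ-defd : Defd D ∅ᵣ w
    ∅ᵣ-defd u u∈ = contradiction u∈ (unlabelled u)

  ρS-wellFormed : {f : Relab k} {b c : Bag k} {S : List W} →
                  b ⊆dom f → ImgIs f b c → WellFormed b S → WellFormed c (ρS f S)
  ρS-wellFormed {f} b⊆f img-f wf fw u fw∈ u∈ with ∈-map⁻ (ρ f) fw∈
  ... | w , w∈ , refl =
    let v , v∈ , f-v = proj₁ (lbl f w (λ v v∈ → b⊆f v (wf w v w∈ v∈)) u) u∈
    in proj₂ (img-f u) (v , wf w v w∈ v∈ , f-v)

  Defd-∘ : (g f : Relab k) {w : W} → Defd D f w → Lbl (ρ f w) ⊆dom g → Defd D (g ∘ᵣ f) w
  Defd-∘ g f {w} f-defd ρfw⊆g =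
    ⊆dom-∘ g f f-defd (λ z fw∋z → ρfw⊆g z (proj₂ (lbl f w f-defd z) fw∋z))

  DefdS-∘-step : (g f : Relab k) {b : Bag k} {S L : List W} → WellFormed b S → b ⊆dom g →
                 S ≋ ρS f L → DefdS D f L → DefdS D (g ∘ᵣ f) L
  DefdS-∘-step g f {S = S} wf b⊆g S≋ f-defd x u x∈ =
    Defd-∘ g f (λ v → f-defd x v x∈) (λ v v∈ → b⊆g v (wf (ρ f x) v ρfx∈S v∈)) u
    where
    ρfx∈S : ρ f x ∈ₗ S
    ρfx∈S = proj₂ (S≋ (ρ f x)) (∈-map⁺ (ρ f) x∈)

  ρ-∘ : (g f : Relab k) {w : W} → Defd D (g ∘ᵣ f) w → ρ g (ρ f w) ≡ ρ (g ∘ᵣ f) w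
  ρ-∘ g f {w} gf-defd = sym (compose (g ∘ᵣ f) g f w (λ _ → refl) gf-defd)

  ρS-∘-step : {g f : Relab k} {S L : List W} → S ≋ ρS f L → DefdS D (g ∘ᵣ f) L →
              ρS g S ≋ ρS (g ∘ᵣ f) L
  ρS-∘-step {g} {f} {S} {L} S≋ gf-defd = begin
    ρS g S               ≈⟨ map-cong-≋ (ρ g) S≋ ⟩
    ρS g (ρS f L)        ≡⟨ map-∘ L ⟨
    map (ρ g ∘ ρ f) L    ≡⟨ map-cong-local (tabulate λ {x} x∈ → ρ-∘ g f λ u → gf-defd x u x∈) ⟩
    ρS (g ∘ᵣ f) L        ∎
    where open ≋-Reasoning

  ρS-extends : {f f′ : Relab k} {S : List W} → Extends f′ f → DefdS D f S → ρS f′ S ≡ ρS f S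
  ρS-extends {f} {f′} ext defd =
    map-cong-local (tabulate λ {x} x∈ → extend f f′ x ext λ u → defd x u x∈)

  ρS-IntroVertexS : {h : Relab k} {u u′ : Lab k} {S : List W} → fn h u ≡ just u′ →
                    DefdS D h S → DefdS D h (IntroVertexS u S) →
                    ρS h (IntroVertexS u S) ≋ IntroVertexS u′ (ρS h S)
  ρS-IntroVertexS {h} {u} {u′} h-u defd op-defd =
    map-concatMap-≋ (ρ h) (IntroVertexW u) (IntroVertexW u′) λ {w} w∈ →
      introV h u u′ w h-u (λ v → defd w v w∈) (DefdS-concatMap⁻ h (IntroVertexW u) op-defd w∈)

  ρS-ForgetVertexS : {h : Relab k} {u u′ : Lab k} {S : List W} → fn h u ≡ just u′ →
                     DefdS D h S → DefdS D h (ForgetVertexS u S) →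
                     ρS h (ForgetVertexS u S) ≋ ForgetVertexS u′ (ρS h S)
  ρS-ForgetVertexS {h} {u} {u′} h-u defd op-defd =
    map-concatMap-≋ (ρ h) (ForgetVertexW u) (ForgetVertexW u′) λ {w} w∈ →
      forgetV h u u′ w h-u (λ v → defd w v w∈) (DefdS-concatMap⁻ h (ForgetVertexW u) op-defd w∈)

  ρS-IntroEdgeS : {h : Relab k} {u u′ v v′ : Lab k} {S : List W} →
                  u ≢ v → fn h u ≡ just u′ → fn h v ≡ just v′ →
                  DefdS D h S → DefdS D h (IntroEdgeS u v S) →
                  ρS h (IntroEdgeS u v S) ≋ IntroEdgeS u′ v′ (ρS h S)
  ρS-IntroEdgeS {h} {u} {u′} {v} {v′} u≢v h-u h-v defd op-defd =
    map-concatMap-≋ (ρ h) (IntroEdgeW u v) (IntroEdgeW u′ v′) λ {w} w∈ →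
      introE h u u′ v v′ w u≢v h-u h-v (λ x → defd w x w∈)
        (DefdS-concatMap⁻ h (IntroEdgeW u v) op-defd w∈)

  ρS-JoinS : {h : Relab k} {S S′ : List W} →
             DefdS D h S → DefdS D h S′ → DefdS D h (JoinS S S′) →
             ρS h (JoinS S S′) ≋ JoinS (ρS h S) (ρS h S′)
  ρS-JoinS {h} {S} {S′} defd defd′ op-defd = map-concatMap-≋ (ρ h) _ _ λ {w} w∈ →
    map-concatMap-≋ (ρ h) (JoinW w) (JoinW (ρ h w)) λ {w′} w′∈ →
      join h w w′ (λ u → defd w u w∈) (λ u → defd′ w′ u w′∈)
        (DefdS-concatMap⁻ h (JoinW w) (row-defd w∈) w′∈)
    where
    row-defd : ∀ {w} → w ∈ₗ S → DefdS D h (concatMap (JoinW w) S′)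
    row-defd = DefdS-concatMap⁻ h (λ w → concatMap (JoinW w) S′) op-defd

module Construction {k : ℕ} (D : DPCore k) (A : WitnessAction D) where
  open DPCore D
  open WitnessAction A
  open Refutation D A
  open CoreProperties D
  open ActionProperties A
  open ≋-Reasoning

  record Decomposition (g : Relab k) (st : State) : Set where
    field
      tree      : DTerm
      legal     : Legal (term tree)
      bag-image : ImgIs g (bag st) (B (term tree))
      wits-ρ    : T tree ≋ ρS g (wits st)
      coherent  : Coherent tree

  Decomposable : State → Set
  Decomposable st = ∀ g → bag st ⊆dom g → Decomposition g st

  leaf-decomposable : {st : State} →
                      bag st ≡ ⊥ → wits st ≋ LeafW → WellFormed (bag st) (wits st) → Decomposable st
  leaf-decomposable {st} b≡⊥ S≋Leaf wf g _ = record
    { tree      = dLeaf LeafW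
    ; legal     = tt
    ; bag-image = subst (λ b → ImgIs g b ⊥) (sym b≡⊥) (ImgIs-⊥ g)
    ; wits-ρ    = begin
        LeafW           ≈⟨ S≋Leaf ⟨
        wits st         ≡⟨ map-id-local (tabulate λ w∈ → ρ-unlabelled g (unlabelled w∈)) ⟨
        ρS g (wits st)  ∎
    ; coherent  = ≋-refl
    }
    where
    unlabelled : ∀ {w} → w ∈ₗ wits st → ∀ u → u ∉ Lbl w
    unlabelled {w} w∈ u u∈ = ∉⊥ (subst (u ∈_) b≡⊥ (wf w u w∈ u∈))

  introVertex-decomposable :
    ∀ {bj Sj u f st} → Decomposable ⟨ bj , Sj ⟩ → WellFormed bj Sj → u ∉ bj →
    DomIs f (bj ∪ ⁅ u ⁆) → DefdS D f (IntroVertexS u Sj) → ImgIs f (bj ∪ ⁅ u ⁆) (bag st) →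
    wits st ≋ ρS f (IntroVertexS u Sj) → WellFormed (bag st) (wits st) → Decomposable st
  introVertex-decomposable {bj} {Sj} {u} {f} {st}
                           decompose wf-j u∉bj dom-f f-defd img-f S≋ wf g b⊆g = record
    { tree      = dIntroVertex (IntroVertexS u′ (T τ₁)) u′ τ₁
    ; legal     = legal₁ , u′∉
    ; bag-image = ImgIs-∘ g f img-f (ImgIs-insert h img₁ h-u)
    ; wits-ρ    = begin
        IntroVertexS u′ (T τ₁)     ≈⟨ concatMap-congʳ-≋ (IntroVertexW u′) T₁≋ ⟩
        IntroVertexS u′ (ρS h Sj)  ≈⟨ ρS-IntroVertexS h-u Sj-defd h-defd ⟨
        ρS h (IntroVertexS u Sj)   ≈⟨ ρS-∘-step S≋ h-defd ⟨
        ρS g (wits st)             ∎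
    ; coherent  = ≋-refl , coherent₁
    }
    where
    h : Relab k
    h = g ∘ᵣ f
    h-dom : (bj ∪ ⁅ u ⁆) ⊆dom h
    h-dom = ⊆dom-∘-img g f dom-f img-f b⊆g
    h-dom-j : bj ⊆dom h
    h-dom-j v v∈ = h-dom v (x∈p∪q⁺ (inj₁ v∈))
    Sj-defd : DefdS D h Sj
    Sj-defd = wellFormed⇒DefdS h wf-j h-dom-j
    h-defd : DefdS D h (IntroVertexS u Sj)
    h-defd = DefdS-∘-step g f wf b⊆g S≋ f-defd
    u′ : Lab k
    u′ = proj₁ (h-dom u (x∈p∪q⁺ (inj₂ (x∈⁅x⁆ u))))
    h-u : fn h u ≡ just u′
    h-u = proj₂ (h-dom u (x∈p∪q⁺ (inj₂ (x∈⁅x⁆ u))))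
    open Decomposition (decompose h h-dom-j)
      renaming (tree to τ₁; legal to legal₁; bag-image to img₁; wits-ρ to T₁≋; coherent to coherent₁)
    u′∉ : u′ ∉ B (term τ₁)
    u′∉ u′∈ = let v , v∈ , h-v = proj₁ (img₁ u′) u′∈
              in u∉bj (subst (_∈ bj) (inj h v u u′ h-v h-u) v∈)

  introEdge-decomposable :
    ∀ {bj Sj u v f st} → Decomposable ⟨ bj , Sj ⟩ → WellFormed bj Sj → u ∈ bj → v ∈ bj → u ≢ v →
    DomIs f bj → DefdS D f (IntroEdgeS u v Sj) → ImgIs f bj (bag st) →
    wits st ≋ ρS f (IntroEdgeS u v Sj) → WellFormed (bag st) (wits st) → Decomposable st
  introEdge-decomposable {bj} {Sj} {u} {v} {f} {st}
                         decompose wf-j u∈bj v∈bj u≢v dom-f f-defd img-f S≋ wf g b⊆g = record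
    { tree      = dIntroEdge (IntroEdgeS u′ v′ (T τ₁)) u′ v′ τ₁
    ; legal     = legal₁ , proj₂ (img₁ u′) (u , u∈bj , h-u) , proj₂ (img₁ v′) (v , v∈bj , h-v)
                , u′≢v′
    ; bag-image = ImgIs-∘ g f img-f img₁
    ; wits-ρ    = begin
        IntroEdgeS u′ v′ (T τ₁)     ≈⟨ concatMap-congʳ-≋ (IntroEdgeW u′ v′) T₁≋ ⟩
        IntroEdgeS u′ v′ (ρS h Sj)  ≈⟨ ρS-IntroEdgeS u≢v h-u h-v Sj-defd h-defd ⟨
        ρS h (IntroEdgeS u v Sj)    ≈⟨ ρS-∘-step S≋ h-defd ⟨
        ρS g (wits st)              ∎
    ; coherent  = ≋-refl , coherent₁
    }
    where
    h : Relab k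
    h = g ∘ᵣ f
    h-dom : bj ⊆dom h
    h-dom = ⊆dom-∘-img g f dom-f img-f b⊆g
    h-defd : DefdS D h (IntroEdgeS u v Sj)
    h-defd = DefdS-∘-step g f wf b⊆g S≋ f-defd
    u′ : Lab k
    u′ = proj₁ (h-dom u u∈bj)
    h-u : fn h u ≡ just u′
    h-u = proj₂ (h-dom u u∈bj)
    v′ : Lab k
    v′ = proj₁ (h-dom v v∈bj)
    h-v : fn h v ≡ just v′
    h-v = proj₂ (h-dom v v∈bj)
    Sj-defd : DefdS D h Sj
    Sj-defd = wellFormed⇒DefdS h wf-j h-dom
    u′≢v′ : u′ ≢ v′
    u′≢v′ u′≡v′ = u≢v (inj h u v v′ (trans h-u (cong just u′≡v′)) h-v)
    open Decomposition (decompose h h-dom)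
      renaming (tree to τ₁; legal to legal₁; bag-image to img₁; wits-ρ to T₁≋; coherent to coherent₁)

  forgetVertex-decomposable :
    ∀ {bj Sj u f st} → Decomposable ⟨ bj , Sj ⟩ → WellFormed bj Sj → u ∈ bj →
    DomIs f (bj - u) → DefdS D f (ForgetVertexS u Sj) → ImgIs f (bj - u) (bag st) →
    wits st ≋ ρS f (ForgetVertexS u Sj) → WellFormed (bag st) (wits st) → Decomposable st
  forgetVertex-decomposable {bj} {Sj} {u} {f} {st}
                            decompose wf-j u∈bj dom-f f-defd img-f S≋ wf g b⊆g = record
    { tree      = dForgetVertex (ForgetVertexS y (T τ₁)) y τ₁
    ; legal     = legal₁ , proj₂ (img₁ y) (u , u∈bj , h′-u)
    ; bag-image = ImgIs-∘ g f img-f (ImgIs-cong h′ h h′≗h (ImgIs-remove h′ img₁ h′-u))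
    ; wits-ρ    = begin
        ForgetVertexS y (T τ₁)      ≈⟨ concatMap-congʳ-≋ (ForgetVertexW y) T₁≋ ⟩
        ForgetVertexS y (ρS h′ Sj)  ≈⟨ ρS-ForgetVertexS h′-u Sj-defd h′-defd ⟨
        ρS h′ (ForgetVertexS u Sj)  ≡⟨ ρS-extends h′-extends h-defd ⟩
        ρS h (ForgetVertexS u Sj)   ≈⟨ ρS-∘-step S≋ h-defd ⟨
        ρS g (wits st)              ∎
    ; coherent  = ≋-refl , coherent₁
    }
    where
    h : Relab k
    h = g ∘ᵣ f
    h-dom : (bj - u) ⊆dom h
    h-dom = ⊆dom-∘-img g f dom-f img-f b⊆g
    h-defd : DefdS D h (ForgetVertexS u Sj)
    h-defd = DefdS-∘-step g f wf b⊆g S≋ f-defd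
    h-u : fn h u ≡ nothing
    h-u = cong (_>>= fn g) (∉dom⇒nothing f λ u∈dom-f → x∈p-y⇒x≢y (proj₂ (dom-f u) u∈dom-f) refl)
    unused : ∃ λ y → ¬ InImage h y
    unused = ∃-unused-label h h-u
    y : Lab k
    y = proj₁ unused
    y-fresh : ¬ InImage h y
    y-fresh = proj₂ unused
    h′ : Relab k
    h′ = extendAt h u y y-fresh
    h′-u : fn h′ u ≡ just y
    h′-u = extendAt-at h u y y-fresh
    h′≗h : ∀ v → v ∈ bj - u → fn h′ v ≡ fn h v
    h′≗h v v∈ = extendAt-off h u y y-fresh (x∈p-y⇒x≢y v∈)
    h′-extends : Extends h′ h
    h′-extends = extendAt-extends h u y y-fresh h-u
    h′-dom : bj ⊆dom h′
    h′-dom = ⊆dom-extendAt h u y y-fresh h-dom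
    Sj-defd : DefdS D h′ Sj
    Sj-defd = wellFormed⇒DefdS h′ wf-j h′-dom
    h′-defd : DefdS D h′ (ForgetVertexS u Sj)
    h′-defd x v x∈ v∈ = let z , h-v = h-defd x v x∈ v∈ in z , h′-extends v z h-v
    open Decomposition (decompose h′ h′-dom)
      renaming (tree to τ₁; legal to legal₁; bag-image to img₁; wits-ρ to T₁≋; coherent to coherent₁)

  join-decomposable :
    ∀ {bj Sj Sl π f st} → Decomposable ⟨ bj , Sj ⟩ → WellFormed bj Sj →
    Decomposable ⟨ bj , Sl ⟩ → WellFormed bj Sl → IsPerm π bj →
    DomIs f bj → DefdS D f (JoinS Sj (ρS π Sl)) → ImgIs f bj (bag st) →
    wits st ≋ ρS f (JoinS Sj (ρS π Sl)) → WellFormed (bag st) (wits st) → Decomposable st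
  join-decomposable {bj} {Sj} {Sl} {π} {f} {st}
                    decompose₁ wf₁ decompose₂ wf₂ (dom-π , img-π) dom-f f-defd img-f S≋ wf g b⊆g = record
    { tree      = dJoin (JoinS (T τ₁) (T τ₂)) τ₁ τ₂
    ; legal     = legal₁ , legal₂ , ImgIs-unique h img₁ (ImgIs-∘ h π img-π img₂)
    ; bag-image = ImgIs-∘ g f img-f img₁
    ; wits-ρ    = begin
        JoinS (T τ₁) (T τ₂)                ≈⟨ JoinS-cong T₁≋ (≋-trans T₂≋ (≋-sym πSl-ρ)) ⟩
        JoinS (ρS h Sj) (ρS h (ρS π Sl))  ≈⟨ ρS-JoinS Sj-defd πSl-defd h-defd ⟨
        ρS h (JoinS Sj (ρS π Sl))          ≈⟨ ρS-∘-step S≋ h-defd ⟨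
        ρS g (wits st)                     ∎
    ; coherent  = ≋-refl , coherent₁ , coherent₂
    }
    where
    h : Relab k
    h = g ∘ᵣ f
    h-dom : bj ⊆dom h
    h-dom = ⊆dom-∘-img g f dom-f img-f b⊆g
    h-defd : DefdS D h (JoinS Sj (ρS π Sl))
    h-defd = DefdS-∘-step g f wf b⊆g S≋ f-defd
    hπ-dom : bj ⊆dom (h ∘ᵣ π)
    hπ-dom = ⊆dom-∘-img h π dom-π img-π h-dom
    hπ-defd : DefdS D (h ∘ᵣ π) Sl
    hπ-defd = wellFormed⇒DefdS (h ∘ᵣ π) wf₂ hπ-dom
    πSl-ρ : ρS h (ρS π Sl) ≋ ρS (h ∘ᵣ π) Sl
    πSl-ρ = ρS-∘-step ≋-refl hπ-defd
    Sj-defd : DefdS D h Sj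
    Sj-defd = wellFormed⇒DefdS h wf₁ h-dom
    πSl-defd : DefdS D h (ρS π Sl)
    πSl-defd = wellFormed⇒DefdS h (ρS-wellFormed (λ v → proj₁ (dom-π v)) img-π wf₂) h-dom
    open Decomposition (decompose₁ h h-dom)
      renaming (tree to τ₁; legal to legal₁; bag-image to img₁; wits-ρ to T₁≋; coherent to coherent₁)
    open Decomposition (decompose₂ (h ∘ᵣ π) hπ-dom)
      renaming (tree to τ₂; legal to legal₂; bag-image to img₂; wits-ρ to T₂≋; coherent to coherent₂)

  step-decomposable :
    ∀ {earlier f st} →
    (∀ {st′} → earlier st′ → Decomposable st′ × WellFormed (bag st′) (wits st′)) →
    Step earlier f st → WellFormed (bag st) (wits st) → Decomposable st
  step-decomposable prev (step-introV _ _ _ e u∉ dom-f defd img-f S≋) =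
    introVertex-decomposable (proj₁ (prev e)) (proj₂ (prev e)) u∉ dom-f defd img-f S≋
  step-decomposable prev (step-forgetV _ _ _ e u∈ dom-f defd img-f S≋) =
    forgetVertex-decomposable (proj₁ (prev e)) (proj₂ (prev e)) u∈ dom-f defd img-f S≋
  step-decomposable prev (step-introE _ _ _ _ e u∈ v∈ u≢v dom-f defd img-f S≋) =
    introEdge-decomposable (proj₁ (prev e)) (proj₂ (prev e)) u∈ v∈ u≢v dom-f defd img-f S≋
  step-decomposable prev (step-join _ _ _ _ e₁ e₂ perm dom-f defd img-f S≋) =
    join-decomposable (proj₁ (prev e₁)) (proj₂ (prev e₁)) (proj₁ (prev e₂)) (proj₂ (prev e₂))
      perm dom-f defd img-f S≋

  states-decomposable : ∀ {m F R} → SemiRefutation m F R → ∀ i → Decomposable (R i)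
  states-decomposable {m} {F} {R} SR = All.wfRec <-wellFounded 0ℓ (Decomposable ∘ R) decompose
    where
    open SemiRefutation SR
    decompose : ∀ i → (∀ {j} → j <ᶠ i → Decomposable (R j)) → Decomposable (R i)
    decompose fzero    _  = leaf-decomposable initial-bag initial-wits (well-formed fzero)
    decompose (fsuc i) IH = step-decomposable earlier (steps i) (well-formed (fsuc i))
      where
      earlier : ∀ {st} → (∃ λ j → toℕ j ≤ toℕ i × R j ≡ st) →
                Decomposable st × WellFormed (bag st) (wits st)
      earlier (j , j≤i , refl) = IH (s≤s j≤i) , well-formed j

lemma8 : (k : ℕ) (D : DPCore k) (A : WitnessAction D)
         (m : ℕ) (F : Fin m → Relab k) (R : Fin (suc m) → Refutation.State D A) →
         Refutation.SemiRefutation D A m F R →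
         (g : Relab k) → DomIs g (Refutation.bag (R (fromℕ m))) →
         ∃ λ (τ : Refutation.DTerm D A) →
           Legal (Refutation.term D A τ)
           × ImgIs g (Refutation.bag (R (fromℕ m))) (B (Refutation.term D A τ))
           × Refutation.T D A τ ≋ WitnessAction.ρS A g (Refutation.wits (R (fromℕ m)))
           × Refutation.Coherent D A τ
lemma8 k D A m F R SR g dom-g = tree , legal , bag-image , wits-ρ , coherent
  where
  open Construction D A
  open Decomposition (states-decomposable SR (fromℕ m) g (λ u → proj₁ (dom-g u)))
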